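{- Let $g(m)$ denote the minimum of $\operatorname{th_{dim}}(G)$ over all graphs $G$ with exactly $m$ edges. Then $g(m)=\Theta\left(\frac{\log m}{\log\log m}\right)$.
   Context: All graphs are finite and simple. $\operatorname{dist}(u,v)$ is the shortest-path distance ($\infty$ across components). For a nonnegative integer $r$, $\operatorname{dist}_r(x,v)=\min(\operatorname{dist}(x,v),r+1)$. A set $S\subseteq V(G)$ is a distance-$r$ resolving set if for all distinct $x,y\in V(G)$ there is $v\in S$ with $\operatorname{dist}_r(v,x)\ne\operatorname{dist}_r(v,y)$. $\dim_r(G)$ is the minimum size of such a set and $\operatorname{th_{dim}}(G)=\min_{r\ge0}(r+\dim_r(G))$ over nonnegative integers $r$. -}

module Defs where

open import Data.Nat using (ℕ; zero; suc; _+_; _*_; _<ᵇ_; _≤_)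
open import Data.Bool using (Bool; true; false; _∧_; _∨_; if_then_else_)
open import Data.Fin using (Fin; toℕ)
open import Data.Fin.Properties using (_≟_)
open import Data.Fin.Subset using (Subset; _∈_; ∣_∣)
open import Data.List using (List; map; allFin)
open import Data.Nat.ListAction using (sum)
open import Data.Bool.ListAction using (any)
open import Data.Product using (Σ; ∃; _×_)
open import Relation.Binary.PropositionalEquality using (_≡_; _≢_)
open import Relation.Nullary.Decidable using (⌊_⌋)

record Graph : Set where
  field
    n      : ℕ
    adj    : Fin n → Fin n → Bool
    sym    : ∀ i j → adj i j ≡ adj j i
    irrefl : ∀ i → adj i i ≡ false
open Graph public

edgeCount : Graph → ℕ
edgeCount G = sum (map (λ i → sum (map (λ j →
  if (toℕ i <ᵇ toℕ j) ∧ adj G i j then 1 else 0) (allFin (n G)))) (allFin (n G)))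

reach : (G : Graph) → ℕ → Fin (n G) → Fin (n G) → Bool
reach G zero    x y = ⌊ x ≟ y ⌋
reach G (suc k) x y = reach G k x y ∨ any (λ z → reach G k x z ∧ adj G z y) (allFin (n G))

search : (G : Graph) → Fin (n G) → Fin (n G) → ℕ → ℕ → ℕ
search G x y k zero    = k
search G x y k (suc f) = if reach G k x y then k else search G x y (suc k) f

-- dist_r(x,y) = min(dist(x,y), r+1)   (dist = ∞ across components)
distR : (G : Graph) → ℕ → Fin (n G) → Fin (n G) → ℕ
distR G r x y = search G x y 0 (suc r)

Resolving : (G : Graph) → ℕ → Subset (n G) → Set
Resolving G r S = ∀ x y → x ≢ y → ∃ λ v → v ∈ S × distR G r v x ≢ distR G r v y

-- Lower bound: a distance-r resolving set S separates the n vertices by their truncated distance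
-- vectors in {0, …, r+1}^S, so m ≤ n² ≤ (r+2)^(2|S|); taking logarithms twice gives
-- log m = O((r + |S|) log log m).
--
-- Upper bound: take as vertices the points p of [0, 3w]^k with |p l - 2w| ≤ p a whenever a ≢ l, and
-- as landmark l the point with coordinate l equal to 0 and all others 2w. From a point with p l > 0
-- one can retreat, inside the region, to a point whose coordinate l is one smaller and whose other
-- coordinates moved by at most one. In any graph that contains all retreat steps and only pairs at
-- sup-distance ≤ 1, coordinate l is exactly the distance from landmark l, so the k landmarks resolve
-- it with r = 3w. There are at most 2k(3w+1)^k retreat steps and about (4w)^k/2 close pairs, so
-- every m in between is the number of edges of such a graph. With w = k these ranges overlap for
-- consecutive k ≥ 64, and the k that fits m has r + |S| ≤ 4k = O(log m / log log m).

module Submission where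

open import Defs hiding (sym)

open import Data.Bool.Base using (Bool; true; false; T; _∧_; _∨_; if_then_else_)
open import Data.Bool.Properties using (T-≡; T-∧; T-∨; T?; ∨-comm; ∨-identityʳ)
open import Data.Empty using (⊥-elim)
open import Data.Fin.Base using (Fin; zero; suc; toℕ; fromℕ<; combine; finToFun; funToFin)
open import Data.Fin.Properties
  using (_≟_; suc-injective; toℕ-injective; toℕ<n; toℕ-fromℕ<; combine-injective; injective⇒≤;
         finToFun-funToFin; funToFin-finToFin; all?; any?; ¬∀⟶∃¬)
open import Data.Fin.Subset using (Subset; _∈_; ∣_∣; ⁅_⁆; _∪_; ⊥)
open import Data.Fin.Subset.Properties using (x∈⁅x⁆; ∣⁅x⁆∣≡1; ∣⊥∣≡0; x∈p∪q⁺)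
open import Data.List.Base as List using (List; []; _∷_; allFin; filter; cartesianProductWith; upTo)
open import Data.List.Properties using (map-tabulate)
open import Data.List.Membership.Propositional using (lose) renaming (_∈_ to _∈ₗ_)
open import Data.List.Membership.Propositional.Properties
  using (∈-filter⁺; ∈-filter⁻; ∈-allFin; ∈-lookup; ∈-cartesianProductWith⁺; ∈-upTo⁺)
import Data.List.Relation.Unary.All as All
open import Data.List.Relation.Unary.AllPairs using ([]; _∷_)
open import Data.List.Relation.Unary.Any as Any using (index; satisfied)
open import Data.List.Relation.Unary.Any.Properties using (lookup-index; any⁺; any⁻)
open import Data.List.Relation.Unary.Unique.Propositional using (Unique)
open import Data.List.Relation.Unary.Unique.Propositional.Properties
  using (cartesianProductWith⁺; upTo⁺; filter⁺)
open import Data.Nat.Base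
open import Data.Nat.ListAction as ListAction using ()
open import Data.Nat.Logarithm using (⌊log₂_⌋; ⌊log₂⌋-mono-≤; ⌊log₂[2^n]⌋≡n; ⌊log₂⌊n/2⌋⌋≡⌊log₂n⌋∸1)
open import Data.Nat.Properties hiding (suc-injective) renaming (_≟_ to _≟ℕ_)
open import Algebra.Properties.Semiring.Sum +-*-semiring
  using (sum; sum-syntax; sum-cong-≗; ∑-comm; ∑-distrib-+; *-distribˡ-sum)
open import Data.Nat.Tactic.RingSolver using (solve-∀)
open import Data.Product.Base using (∃; _×_; _,_; proj₁; proj₂)
open import Data.Sum.Base using (_⊎_; inj₁; inj₂; [_,_]′) renaming (map to map-⊎)
open import Data.Vec.Base using (Vec; []; _∷_; here; there; lookup; tabulate)
open import Data.Vec.Properties using (lookup∘tabulate; tabulate∘lookup; tabulate-cong; ∷-injective)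
open import Function.Base using (_∘_; id)
open import Function.Bundles using (Equivalence)
open import Function.Definitions using (Injective)
open import Relation.Binary.Definitions using (tri<; tri≈; tri>)
open import Relation.Binary.PropositionalEquality
  using (_≡_; _≢_; refl; sym; trans; cong; cong₂; subst; subst₂; _≗_; module ≡-Reasoning)
open import Relation.Nullary.Decidable
  using (Dec; yes; no; ⌊_⌋; isYes≗does; map′; toWitness; fromWitness; _×-dec_; _→-dec_; ¬?)
open import Relation.Nullary.Negation using (¬_; contradiction)

χ : Bool → ℕ
χ b = if b then 1 else 0

χ≤1 : ∀ b → χ b ≤ 1
χ≤1 false = z≤n
χ≤1 true  = ≤-refl

χ-mono : ∀ {a b} → (T a → T b) → χ a ≤ χ b
χ-mono {false} _ = z≤n
χ-mono {true} {false} a⇒b = ⊥-elim (a⇒b _)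
χ-mono {true} {true}  _   = ≤-refl

χ-scale : ∀ {b} n {m} → (T b → n ≤ m) → n * χ b ≤ m
χ-scale {false} n _   = ≤-trans (≤-reflexive (*-zeroʳ n)) z≤n
χ-scale {true}  n n≤m = ≤-trans (≤-reflexive (*-identityʳ n)) (n≤m _)

χ-split : ∀ {x y c c′ d} → (¬ T d → T x ⊎ T y) → (T c → T c′) → χ c ≤ (χ (x ∧ c) + χ (y ∧ c′)) + χ d
χ-split {d = true}                              _     _    = ≤-trans (χ≤1 _) (m≤n+m 1 _)
χ-split {c = false}                             _     _    = z≤n
χ-split {true}  {_}     {true} {_}     {false} _     _    = s≤s z≤n
χ-split {false} {true}  {true} {true}  {false} _     _    = s≤s z≤n
χ-split {false} {true}  {true} {false} {false} _     c⇒c′ = ⊥-elim (c⇒c′ _)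
χ-split {false} {false} {true} {_}     {false} x⊎y   _    with x⊎y id
... | inj₁ ()
... | inj₂ ()

∑-mono-≤ : ∀ {n} {f g : Fin n → ℕ} → (∀ i → f i ≤ g i) → sum f ≤ sum g
∑-mono-≤ {zero}  _   = z≤n
∑-mono-≤ {suc n} f≤g = +-mono-≤ (f≤g zero) (∑-mono-≤ (f≤g ∘ suc))

∑-≤-* : ∀ {n} {f : Fin n → ℕ} b → (∀ i → f i ≤ b) → sum f ≤ n * b
∑-≤-* {zero}  b _   = z≤n
∑-≤-* {suc n} b f≤b = +-mono-≤ (f≤b zero) (∑-≤-* b (f≤b ∘ suc))

sum-tabulate : ∀ {n} (f : Fin n → ℕ) → ListAction.sum (List.tabulate f) ≡ sum f
sum-tabulate {zero}  f = refl
sum-tabulate {suc n} f = cong (f zero +_) (sum-tabulate (f ∘ suc))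

sum-allFin : ∀ {n} (f : Fin n → ℕ) → ListAction.sum (List.map f (allFin n)) ≡ sum f
sum-allFin f = trans (cong ListAction.sum (map-tabulate id f)) (sum-tabulate f)

∑χ≤1 : ∀ {n} (p : Fin n → Bool) → (∀ {i j} → T (p i) → T (p j) → i ≡ j) → ∑[ i < n ] χ (p i) ≤ 1
∑χ≤1 {zero}  p unique = z≤n
∑χ≤1 {suc n} p unique with p zero in p0
... | false = ∑χ≤1 (p ∘ suc) (λ pi pj → suc-injective (unique pi pj))
... | true  = s≤s (≤-trans (∑-≤-* 0 rest≤0) (≤-reflexive (*-zeroʳ n)))
  where
  rest≤0 : ∀ i → χ (p (suc i)) ≤ 0
  rest≤0 i with p (suc i) in pi
  ... | false = z≤n
  ... | true  with () ← unique (subst T (sym pi) _) (subst T (sym p0) _)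

χ-any≤∑χ : ∀ {n} {P : Fin n → Set} (P? : ∀ i → Dec (P i)) → χ ⌊ any? P? ⌋ ≤ ∑[ i < n ] χ ⌊ P? i ⌋
χ-any≤∑χ {zero}  P? = z≤n
χ-any≤∑χ {suc n} P? rewrite isYes≗does (any? P?) with P? zero
... | yes _ = s≤s z≤n
... | no  _ = subst (λ b → χ b ≤ ∑[ i < n ] χ ⌊ P? (suc i) ⌋) (isYes≗does (any? (P? ∘ suc)))
                    (χ-any≤∑χ (P? ∘ suc))

length-filter-tabulate : ∀ {A : Set} {n} (p : A → Bool) (f : Fin n → A) →
                         List.length (filter (T? ∘ p) (List.tabulate f)) ≡ ∑[ i < n ] χ (p (f i))
length-filter-tabulate {n = zero}  p f = refl
length-filter-tabulate {n = suc n} p f with p (f zero)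
... | true  = cong suc (length-filter-tabulate p (f ∘ suc))
... | false = length-filter-tabulate p (f ∘ suc)

injective⇒≤∑χ : ∀ {N M} (p : Fin M → Bool) {f : Fin N → Fin M} → Injective _≡_ _≡_ f →
                (∀ x → T (p (f x))) → N ≤ ∑[ y < M ] χ (p y)
injective⇒≤∑χ {N} {M} p {f} f-injective pf =
  ≤-trans (injective⇒≤ position-injective) (≤-reflexive (length-filter-tabulate p id))
  where
  ys = filter (T? ∘ p) (allFin M)
  f∈ys : ∀ x → f x ∈ₗ ys
  f∈ys x = ∈-filter⁺ (T? ∘ p) (∈-allFin (f x)) (pf x)
  position : Fin N → Fin (List.length ys)
  position x = index (f∈ys x)
  position-injective : Injective _≡_ _≡_ position
  position-injective {x} {y} eq =
    f-injective (trans (lookup-index (f∈ys x)) (trans (cong (List.lookup ys) eq) (sym (lookup-index (f∈ys y)))))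

^-distribʳ-* : ∀ a b n → (a * b) ^ n ≡ a ^ n * b ^ n
^-distribʳ-* a b zero    = refl
^-distribʳ-* a b (suc n) = trans (cong (a * b *_) (^-distribʳ-* a b n)) (interchange a b (a ^ n) (b ^ n))
  where
  interchange : ∀ a b c d → a * b * (c * d) ≡ a * c * (b * d)
  interchange = solve-∀

2*⌊n/2⌋≤n : ∀ n → 2 * ⌊ n /2⌋ ≤ n
2*⌊n/2⌋≤n n = begin
  2 * ⌊ n /2⌋          ≡⟨ cong (⌊ n /2⌋ +_) (+-identityʳ ⌊ n /2⌋) ⟩
  ⌊ n /2⌋ + ⌊ n /2⌋    ≤⟨ +-monoʳ-≤ ⌊ n /2⌋ (⌊n/2⌋≤⌈n/2⌉ n) ⟩
  ⌊ n /2⌋ + ⌈ n /2⌉    ≡⟨ ⌊n/2⌋+⌈n/2⌉≡n n ⟩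
  n                    ∎
  where open ≤-Reasoning

2^≤⇒≤⌊log₂⌋ : ∀ {a n} → 2 ^ a ≤ n → a ≤ ⌊log₂ n ⌋
2^≤⇒≤⌊log₂⌋ {a} 2^a≤n = subst (_≤ _) (⌊log₂[2^n]⌋≡n a) (⌊log₂⌋-mono-≤ 2^a≤n)

<2^⇒⌊log₂⌋≤ : ∀ a {n} → n < 2 ^ suc a → ⌊log₂ n ⌋ ≤ a
<2^⇒⌊log₂⌋≤ zero    {0}           _ = z≤n
<2^⇒⌊log₂⌋≤ zero    {1}           _ = z≤n
<2^⇒⌊log₂⌋≤ zero    {suc (suc n)} (s≤s (s≤s ()))
<2^⇒⌊log₂⌋≤ (suc a) {n}           n<2^ = begin
  ⌊log₂ n ⌋                ≤⟨ m≤n+m∸n ⌊log₂ n ⌋ 1 ⟩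
  1 + (⌊log₂ n ⌋ ∸ 1)      ≡⟨ cong suc (⌊log₂⌊n/2⌋⌋≡⌊log₂n⌋∸1 n) ⟨
  1 + ⌊log₂ ⌊ n /2⌋ ⌋      ≤⟨ s≤s (<2^⇒⌊log₂⌋≤ a {⌊ n /2⌋} ⌊n/2⌋<2^) ⟩
  suc a                    ∎
  where
  open ≤-Reasoning
  ⌊n/2⌋<2^ : ⌊ n /2⌋ < 2 ^ suc a
  ⌊n/2⌋<2^ = *-cancelˡ-< 2 _ _ (≤-<-trans (2*⌊n/2⌋≤n n) n<2^)

2^⌊log₂n⌋≤n : ∀ {n} → 1 ≤ n → 2 ^ ⌊log₂ n ⌋ ≤ n
2^⌊log₂n⌋≤n {n} 1≤n with ⌊log₂ n ⌋ in log≡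
... | zero  = 1≤n
... | suc a = ≮⇒≥ (λ n<2^ → 1+n≰n (subst (_≤ a) log≡ (<2^⇒⌊log₂⌋≤ a n<2^)))

n<2^suc⌊log₂n⌋ : ∀ n → n < 2 ^ suc ⌊log₂ n ⌋
n<2^suc⌊log₂n⌋ n = ≰⇒> (1+n≰n ∘ 2^≤⇒≤⌊log₂⌋)

n<2^n : ∀ n → n < 2 ^ n
n<2^n zero    = s≤s z≤n
n<2^n (suc n) = begin-strict
  suc n          <⟨ s≤s (n<2^n n) ⟩
  suc (2 ^ n)    ≤⟨ +-monoˡ-≤ (2 ^ n) (m^n>0 2 n) ⟩
  2 ^ n + 2 ^ n  ≡⟨ cong (2 ^ n +_) (+-identityʳ (2 ^ n)) ⟨
  2 ^ suc n      ∎
  where open ≤-Reasoning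

1≤^ : ∀ {x} n → 1 ≤ x → 1 ≤ x ^ n
1≤^ zero    _   = ≤-refl
1≤^ (suc n) 1≤x = *-mono-≤ 1≤x (1≤^ n 1≤x)

<2^⇒⌊log₂⌋< : ∀ {a n} → 1 ≤ n → n < 2 ^ a → ⌊log₂ n ⌋ < a
<2^⇒⌊log₂⌋< {a} 1≤n n<2^a =
  ≰⇒> (λ a≤L → <⇒≱ n<2^a (≤-trans (^-monoʳ-≤ 2 a≤L) (2^⌊log₂n⌋≤n 1≤n)))

-- Truncated distances

module _ (G : Graph) where

  reach-refl : ∀ x → T (reach G 0 x x)
  reach-refl x = fromWitness refl

  reach-suc : ∀ {k x z y} → T (reach G k x z) → T (adj G z y) → T (reach G (suc k) x y)
  reach-suc {z = z} x⇝z z~y =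
    Equivalence.from T-∨ (inj₂ (any⁺ _ (lose (∈-allFin z) (Equivalence.from T-∧ (x⇝z , z~y)))))

  Lipschitz : (Fin (n G) → ℕ) → Set
  Lipschitz φ = ∀ {z y} → T (adj G z y) → φ y ≤ suc (φ z)

  reach⇒≤ : ∀ {φ} → Lipschitz φ → ∀ k {x y} → T (reach G k x y) → φ y ≤ φ x + k
  reach⇒≤ {φ} φ-lip zero {x} {y} x⇝y with refl ← toWitness {a? = x ≟ y} x⇝y = m≤m+n (φ x) 0
  reach⇒≤ {φ} φ-lip (suc k) {x} {y} x⇝y with Equivalence.to T-∨ x⇝y
  ... | inj₁ x⇝y′ = ≤-trans (reach⇒≤ φ-lip k x⇝y′) (+-monoʳ-≤ (φ x) (n≤1+n k))
  ... | inj₂ step with z , x⇝z∧z~y ← satisfied (any⁻ _ (allFin (n G)) step)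
                  with x⇝z , z~y ← Equivalence.to T-∧ x⇝z∧z~y = begin
    φ y            ≤⟨ φ-lip z~y ⟩
    suc (φ z)      ≤⟨ s≤s (reach⇒≤ φ-lip k x⇝z) ⟩
    suc (φ x + k)  ≡⟨ +-suc (φ x) k ⟨
    φ x + suc k    ∎
    where open ≤-Reasoning

  search≤ : ∀ x y k f → search G x y k f ≤ k + f
  search≤ x y k zero    = ≤-reflexive (sym (+-identityʳ k))
  search≤ x y k (suc f) with reach G k x y
  ... | true  = m≤m+n k (suc f)
  ... | false = ≤-trans (search≤ x y (suc k) f) (≤-reflexive (sym (+-suc k f)))

  distR≤ : ∀ r x y → distR G r x y ≤ suc r
  distR≤ r x y = search≤ x y 0 (suc r)

  -- A Lipschitz φ vanishing at x bounds dist(x, ·) from below, so a walk of length φ y attains it.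
  distR≡ : ∀ {φ} → Lipschitz φ → ∀ r {x y} → φ x ≡ 0 → φ y ≤ r → T (reach G (φ y) x y) →
           distR G r x y ≡ φ y
  distR≡ {φ} φ-lip r {x} {y} φx≡0 φy≤r x⇝y = search-hits (suc r) 0 z≤n (s≤s φy≤r)
    where
    search-hits : ∀ f k → k ≤ φ y → φ y < k + f → search G x y k f ≡ φ y
    search-hits zero    k k≤φy φy<k+0 = contradiction (≤-trans φy<k+0 (≤-reflexive (+-identityʳ k))) (≤⇒≯ k≤φy)
    search-hits (suc f) k k≤φy φy<k+f with reach G k x y in x⇝y?
    ... | true  = ≤-antisym k≤φy (subst (λ a → φ y ≤ a + k) φx≡0 (reach⇒≤ φ-lip k (subst T (sym x⇝y?) _)))
    ... | false with m≤n⇒m<n∨m≡n k≤φy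
    ...   | inj₂ refl = contradiction (subst T x⇝y? x⇝y) id
    ...   | inj₁ k<φy = search-hits f (suc k) k<φy (<-≤-trans φy<k+f (≤-reflexive (+-suc k f)))

-- The lower bound

code : ∀ {n} q (S : Subset n) → (Fin n → Fin q) → Fin (q ^ ∣ S ∣)
code q []          d = zero
code q (true ∷ S)  d = combine (d zero) (code q S (d ∘ suc))
code q (false ∷ S) d = code q S (d ∘ suc)

code-injective : ∀ {n q} (S : Subset n) {d d′ : Fin n → Fin q} →
                 code q S d ≡ code q S d′ → ∀ {v} → v ∈ S → d v ≡ d′ v
code-injective (true ∷ S) {d} {d′} eq here =
  proj₁ (combine-injective (d zero) _ (d′ zero) _ eq)
code-injective (true ∷ S) {d} {d′} eq (there v∈S) =
  code-injective S (proj₂ (combine-injective (d zero) _ (d′ zero) _ eq)) v∈S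
code-injective (false ∷ S) eq (there v∈S) = code-injective S eq v∈S

resolving⇒n≤ : ∀ G r S → Resolving G r S → n G ≤ (2 + r) ^ ∣ S ∣
resolving⇒n≤ G r S resolves = injective⇒≤ codeOf-injective
  where
  digit : Fin (n G) → Fin (n G) → Fin (2 + r)
  digit x v = fromℕ< (s≤s (distR≤ G r v x))
  codeOf : Fin (n G) → Fin ((2 + r) ^ ∣ S ∣)
  codeOf x = code (2 + r) S (digit x)
  codeOf-injective : Injective _≡_ _≡_ codeOf
  codeOf-injective {x} {y} eq with x ≟ y
  ... | yes x≡y = x≡y
  ... | no x≢y with v , v∈S , differ ← resolves x y x≢y =
    contradiction (trans (sym (toℕ-fromℕ< _)) (trans (cong toℕ (code-injective S eq v∈S)) (toℕ-fromℕ< _))) differ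

edgeCount≤n² : ∀ G → edgeCount G ≤ n G * n G
edgeCount≤n² G = ≤-trans (≤-reflexive (sum-allFin row)) (∑-≤-* (n G) row≤n)
  where
  upperEdge : Fin (n G) → Fin (n G) → ℕ
  upperEdge i j = χ ((toℕ i <ᵇ toℕ j) ∧ adj G i j)
  row : Fin (n G) → ℕ
  row i = ListAction.sum (List.map (upperEdge i) (allFin (n G)))
  row≤n : ∀ i → row i ≤ n G
  row≤n i = begin
    row i                       ≡⟨ sum-allFin (upperEdge i) ⟩
    ∑[ j < n G ] upperEdge i j  ≤⟨ ∑-≤-* {n G} 1 (λ j → χ≤1 _) ⟩
    n G * 1                     ≡⟨ *-identityʳ (n G) ⟩
    n G                         ∎
    where open ≤-Reasoning

log-lowerBound : ∀ m r s → 4 ≤ m → m ≤ (2 + r) ^ s * (2 + r) ^ s →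
                 ⌊log₂ m ⌋ ≤ 4 * ((r + s) * ⌊log₂ ⌊log₂ m ⌋ ⌋)
log-lowerBound m r s 4≤m m≤ = bound (L ≤? r + s)
  where
  open ≤-Reasoning
  L = ⌊log₂ m ⌋
  LL = ⌊log₂ L ⌋
  1≤LL : 1 ≤ LL
  1≤LL = 2^≤⇒≤⌊log₂⌋ (2^≤⇒≤⌊log₂⌋ 4≤m)
  bound : Dec (L ≤ r + s) → L ≤ 4 * ((r + s) * LL)
  bound (yes L≤r+s) = begin
    L                      ≤⟨ L≤r+s ⟩
    r + s                  ≡⟨ *-identityʳ (r + s) ⟨
    (r + s) * 1            ≤⟨ *-monoʳ-≤ (r + s) 1≤LL ⟩
    (r + s) * LL           ≤⟨ m≤n*m _ 4 ⟩
    4 * ((r + s) * LL)     ∎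
  -- Otherwise 2 + r ≤ 1 + L < 2 ^ (1 + LL), so m ≤ (2 + r) ^ (2s) is at most 2 ^ (2 (1 + LL) s).
  bound (no L≰r+s) = begin
    L                          ≤⟨ ⌊log₂⌋-mono-≤ m≤2^ ⟩
    ⌊log₂ (2 ^ (B + B)) ⌋      ≡⟨ ⌊log₂[2^n]⌋≡n (B + B) ⟩
    B + B                      ≤⟨ +-mono-≤ B≤ B≤ ⟩
    2 * LL * s + 2 * LL * s    ≡⟨ rearrange LL s ⟩
    4 * (s * LL)               ≤⟨ *-monoʳ-≤ 4 (*-monoˡ-≤ LL (m≤n+m s r)) ⟩
    4 * ((r + s) * LL)         ∎
    where
    B = suc LL * s
    rearrange : ∀ a b → 2 * a * b + 2 * a * b ≡ 4 * (b * a)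
    rearrange = solve-∀
    B≤ : B ≤ 2 * LL * s
    B≤ = *-monoˡ-≤ s (≤-trans (+-monoˡ-≤ LL 1≤LL) (≤-reflexive (cong (LL +_) (sym (+-identityʳ LL)))))
    2+r≤2^ : 2 + r ≤ 2 ^ suc LL
    2+r≤2^ = ≤-trans (s≤s (≤-trans (s≤s (m≤m+n r s)) (≰⇒> L≰r+s))) (n<2^suc⌊log₂n⌋ L)
    m≤2^ : m ≤ 2 ^ (B + B)
    m≤2^ = begin
      m                                          ≤⟨ m≤ ⟩
      (2 + r) ^ s * (2 + r) ^ s                  ≤⟨ *-mono-≤ (^-monoˡ-≤ s 2+r≤2^) (^-monoˡ-≤ s 2+r≤2^) ⟩
      (2 ^ suc LL) ^ s * (2 ^ suc LL) ^ s        ≡⟨ cong₂ _*_ (^-*-assoc 2 (suc LL) s) (^-*-assoc 2 (suc LL) s) ⟩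
      2 ^ B * 2 ^ B                              ≡⟨ ^-distribˡ-+-* 2 B B ⟨
      2 ^ (B + B)                                ∎

lowerBound : ∀ m → 4 ≤ m → ∀ G → edgeCount G ≡ m → ∀ r S → Resolving G r S →
             ⌊log₂ m ⌋ ≤ 4 * ((r + ∣ S ∣) * ⌊log₂ ⌊log₂ m ⌋ ⌋)
lowerBound m 4≤m G refl r S resolves =
  log-lowerBound m r ∣ S ∣ 4≤m (≤-trans (edgeCount≤n² G) (*-mono-≤ n≤ n≤))
  where
  n≤ : n G ≤ (2 + r) ^ ∣ S ∣
  n≤ = resolving⇒n≤ G r S resolves

-- Graphs with a prescribed number of edges

_≺_ : ∀ {N} → Fin N → Fin N → Bool
i ≺ j = toℕ i <ᵇ toℕ j

≺-irrefl : ∀ {N} (i : Fin N) → (i ≺ i) ≡ false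
≺-irrefl i = <ᵇ-irrefl (toℕ i)
  where
  <ᵇ-irrefl : ∀ m → (m <ᵇ m) ≡ false
  <ᵇ-irrefl zero    = refl
  <ᵇ-irrefl (suc m) = <ᵇ-irrefl m

≺-asym : ∀ {N} {i j : Fin N} → T (i ≺ j) → ¬ T (j ≺ i)
≺-asym {i = i} {j} i≺j j≺i = <-asym (<ᵇ⇒< (toℕ i) (toℕ j) i≺j) (<ᵇ⇒< (toℕ j) (toℕ i) j≺i)

≺-connex : ∀ {N} {i j : Fin N} → i ≢ j → T (i ≺ j) ⊎ T (j ≺ i)
≺-connex {i = i} {j} i≢j with <-cmp (toℕ i) (toℕ j)
... | tri< i<j _ _ = inj₁ (<⇒<ᵇ i<j)
... | tri≈ _ i≡j _ = contradiction (toℕ-injective i≡j) i≢j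
... | tri> _ _ j<i = inj₂ (<⇒<ᵇ j<i)

-- Only the entries C i j with i ≺ j are used.
graphOn : (N : ℕ) → (Fin N → Fin N → Bool) → Graph
graphOn N C = record
  { n      = N
  ; adj    = λ i j → (i ≺ j ∧ C i j) ∨ (j ≺ i ∧ C j i)
  ; sym    = λ i j → ∨-comm (i ≺ j ∧ C i j) (j ≺ i ∧ C j i)
  ; irrefl = irrefl′
  }
  where
  irrefl′ : ∀ i → ((i ≺ i ∧ C i i) ∨ (i ≺ i ∧ C i i)) ≡ false
  irrefl′ i rewrite ≺-irrefl i = refl

edgeCount-graphOn : ∀ N (C : Fin N → Fin N → Bool) → (∀ {i j} → T (C i j) → T (i ≺ j)) →
                    edgeCount (graphOn N C) ≡ ∑[ i < N ] ∑[ j < N ] χ (C i j)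
edgeCount-graphOn N C C⇒≺ =
  trans (sum-allFin (λ i → ListAction.sum (List.map (upper i) (allFin N))))
        (sum-cong-≗ (λ i → trans (sum-allFin (upper i)) (sum-cong-≗ (upper-edge i))))
  where
  upper : Fin N → Fin N → ℕ
  upper i j = χ (i ≺ j ∧ adj (graphOn N C) i j)
  upper-edge : ∀ i j → upper i j ≡ χ (C i j)
  upper-edge i j with i ≺ j in i≺j | C i j in Cij
  ... | false | false = refl
  ... | false | true  = contradiction (subst T i≺j (C⇒≺ (Equivalence.from T-≡ Cij))) id
  ... | true  | c with j ≺ i in j≺i
  ...   | false = cong χ (∨-identityʳ c)
  ...   | true  = contradiction (Equivalence.from T-≡ j≺i) (≺-asym {i = i} {j} (Equivalence.from T-≡ i≺j))

select : ∀ {n} (lo hi : Fin n → ℕ) {m} → (∀ i → lo i ≤ hi i) → sum lo ≤ m → m ≤ sum hi →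
         ∃ λ v → (∀ i → lo i ≤ v i) × (∀ i → v i ≤ hi i) × sum v ≡ m
select {zero} lo hi lo≤hi _ m≤0 = (λ ()) , (λ ()) , (λ ()) , sym (n≤0⇒n≡0 m≤0)
select {suc n} lo hi {m} lo≤hi ∑lo≤m m≤∑hi with m ≤? lo zero + sum (hi ∘ suc)
... | yes m≤lo₀+rest
  with v , lo≤v , v≤hi , ∑v≡ ← select (lo ∘ suc) (hi ∘ suc) (lo≤hi ∘ suc)
         (m+n≤o⇒m≤o∸n (sum (lo ∘ suc)) (≤-trans (≤-reflexive (+-comm _ (lo zero))) ∑lo≤m))
         (m≤n+o⇒m∸n≤o m (lo zero) m≤lo₀+rest) =
  (λ { zero → lo zero ; (suc i) → v i }) ,
  (λ { zero → ≤-refl ; (suc i) → lo≤v i }) ,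
  (λ { zero → lo≤hi zero ; (suc i) → v≤hi i }) ,
  trans (cong (lo zero +_) ∑v≡) (m+[n∸m]≡n (≤-trans (m≤m+n (lo zero) _) ∑lo≤m))
... | no m≰lo₀+rest =
  (λ { zero → m ∸ rest ; (suc i) → hi (suc i) }) ,
  (λ { zero → m+n≤o⇒m≤o∸n (lo zero) (<⇒≤ lo₀+rest<m) ; (suc i) → lo≤hi (suc i) }) ,
  (λ { zero → m≤n+o⇒m∸n≤o m rest (≤-trans m≤∑hi (≤-reflexive (+-comm (hi zero) rest))) ; (suc i) → ≤-refl }) ,
  m∸n+n≡m (≤-trans (m≤n+m rest (lo zero)) (<⇒≤ lo₀+rest<m))
  where
  rest = sum (hi ∘ suc)
  lo₀+rest<m : lo zero + rest < m
  lo₀+rest<m = ≰⇒> m≰lo₀+rest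

χ-between : ∀ {a b} v → (T a → T b) → χ a ≤ v → v ≤ χ b →
            ∃ λ c → (T a → T c) × (T c → T b) × χ c ≡ v
χ-between {true}  {false} _             a⇒b _  _       = ⊥-elim (a⇒b _)
χ-between {true}  {true}  (suc zero)    _   _  _       = true , _ , _ , refl
χ-between {true}  {true}  (suc (suc v)) _   _  (s≤s ())
χ-between {false} {_}     zero          _   _  _       = false , id , (λ ()) , refl
χ-between {false} {true}  (suc zero)    _   _  _       = true , (λ ()) , _ , refl
χ-between {false} {true}  (suc (suc v)) _   _  (s≤s ())

selectᵇ : ∀ {n} (a b : Fin n → Bool) {m} → (∀ i → T (a i) → T (b i)) →
          ∑[ i < n ] χ (a i) ≤ m → m ≤ ∑[ i < n ] χ (b i) →
          ∃ λ c → (∀ i → T (a i) → T (c i)) × (∀ i → T (c i) → T (b i)) × ∑[ i < n ] χ (c i) ≡ m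
selectᵇ a b a⇒b ∑a≤m m≤∑b
  with v , a≤v , v≤b , ∑v≡m ← select (χ ∘ a) (χ ∘ b) (χ-mono ∘ a⇒b) ∑a≤m m≤∑b =
  proj₁ ∘ pick , proj₁ ∘ proj₂ ∘ pick , proj₁ ∘ proj₂ ∘ proj₂ ∘ pick ,
  trans (sum-cong-≗ (proj₂ ∘ proj₂ ∘ proj₂ ∘ pick)) ∑v≡m
  where
  pick : ∀ i → ∃ λ c → (T (a i) → T c) × (T c → T (b i)) × χ c ≡ v i
  pick i = χ-between (v i) (a⇒b i) (a≤v i) (v≤b i)

∑∑-symmetrise : ∀ {N} (f : Fin N → Fin N → ℕ) →
                ∑[ i < N ] ∑[ j < N ] (f i j + f j i) ≡ ∑[ i < N ] ∑[ j < N ] f i j + ∑[ i < N ] ∑[ j < N ] f i j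
∑∑-symmetrise {N} f = begin
  ∑[ i < N ] ∑[ j < N ] (f i j + f j i)
    ≡⟨ sum-cong-≗ (λ i → ∑-distrib-+ (f i) (λ j → f j i)) ⟩
  ∑[ i < N ] (∑[ j < N ] f i j + ∑[ j < N ] f j i)
    ≡⟨ ∑-distrib-+ (λ i → ∑[ j < N ] f i j) (λ i → ∑[ j < N ] f j i) ⟩
  ∑[ i < N ] ∑[ j < N ] f i j + ∑[ i < N ] ∑[ j < N ] f j i
    ≡⟨ cong (∑[ i < N ] ∑[ j < N ] f i j +_) (∑-comm f) ⟨
  ∑[ i < N ] ∑[ j < N ] f i j + ∑[ i < N ] ∑[ j < N ] f i j
    ∎
  where open ≡-Reasoning

count₂ : ∀ {N} → (Fin N → Fin N → Bool) → ℕ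
count₂ {N} R = ∑[ i < N ] ∑[ j < N ] χ (R i j)

select₂ : ∀ {N} (A B : Fin N → Fin N → Bool) {m} → (∀ i j → T (A i j) → T (B i j)) →
          count₂ A ≤ m → m ≤ count₂ B →
          ∃ λ C → (∀ i j → T (A i j) → T (C i j)) × (∀ i j → T (C i j) → T (B i j)) × count₂ C ≡ m
select₂ {N} A B A⇒B A≤m m≤B
  with v , A≤v , v≤B , ∑v≡m ← select (λ i → ∑[ j < N ] χ (A i j)) (λ i → ∑[ j < N ] χ (B i j))
                                     (λ i → ∑-mono-≤ (χ-mono ∘ A⇒B i)) A≤m m≤B =
  proj₁ ∘ row , proj₁ ∘ proj₂ ∘ row , proj₁ ∘ proj₂ ∘ proj₂ ∘ row ,
  trans (sum-cong-≗ (proj₂ ∘ proj₂ ∘ proj₂ ∘ row)) ∑v≡m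
  where
  row : ∀ i → ∃ λ c → (∀ j → T (A i j) → T (c j)) × (∀ j → T (c j) → T (B i j)) × ∑[ j < N ] χ (c j) ≡ v i
  row i = selectᵇ (A i) (B i) (A⇒B i) (A≤v i) (v≤B i)

∣p∪q∣≤∣p∣+∣q∣ : ∀ {n} (p q : Subset n) → ∣ p ∪ q ∣ ≤ ∣ p ∣ + ∣ q ∣
∣p∪q∣≤∣p∣+∣q∣ []          []          = z≤n
∣p∪q∣≤∣p∣+∣q∣ (true ∷ p)  (y ∷ q)     =
  s≤s (≤-trans (∣p∪q∣≤∣p∣+∣q∣ p q) (+-monoʳ-≤ ∣ p ∣ (∣q∣≤∣y∷q∣ y q)))
  where
  ∣q∣≤∣y∷q∣ : ∀ {n} y (q : Subset n) → ∣ q ∣ ≤ ∣ y ∷ q ∣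
  ∣q∣≤∣y∷q∣ true  q = n≤1+n ∣ q ∣
  ∣q∣≤∣y∷q∣ false q = ≤-refl
∣p∪q∣≤∣p∣+∣q∣ (false ∷ p) (true ∷ q)  =
  ≤-trans (s≤s (∣p∪q∣≤∣p∣+∣q∣ p q)) (≤-reflexive (sym (+-suc ∣ p ∣ ∣ q ∣)))
∣p∪q∣≤∣p∣+∣q∣ (false ∷ p) (false ∷ q) = ∣p∪q∣≤∣p∣+∣q∣ p q

image : ∀ {k n} → (Fin k → Fin n) → Subset n
image {zero}  f = ⊥
image {suc k} f = ⁅ f zero ⁆ ∪ image (f ∘ suc)

∈-image : ∀ {k n} (f : Fin k → Fin n) l → f l ∈ image f
∈-image f zero    = x∈p∪q⁺ (inj₁ (x∈⁅x⁆ (f zero)))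
∈-image f (suc l) = x∈p∪q⁺ (inj₂ (∈-image (f ∘ suc) l))

∣image∣≤ : ∀ {k n} (f : Fin k → Fin n) → ∣ image f ∣ ≤ k
∣image∣≤ {zero}  {n} f = ≤-reflexive (∣⊥∣≡0 n)
∣image∣≤ {suc k} f = begin
  ∣ ⁅ f zero ⁆ ∪ image (f ∘ suc) ∣      ≤⟨ ∣p∪q∣≤∣p∣+∣q∣ ⁅ f zero ⁆ (image (f ∘ suc)) ⟩
  ∣ ⁅ f zero ⁆ ∣ + ∣ image (f ∘ suc) ∣  ≤⟨ +-monoˡ-≤ _ (≤-reflexive (∣⁅x⁆∣≡1 (f zero))) ⟩
  1 + ∣ image (f ∘ suc) ∣               ≤⟨ s≤s (∣image∣≤ (f ∘ suc)) ⟩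
  suc k                                 ∎
  where open ≤-Reasoning

funToFin-cong : ∀ {m n} {f g : Fin m → Fin n} → f ≗ g → funToFin f ≡ funToFin g
funToFin-cong {zero}  _   = refl
funToFin-cong {suc m} f≗g = cong₂ combine (f≗g zero) (funToFin-cong (f≗g ∘ suc))

funToFin-injective : ∀ {m n} {f g : Fin m → Fin n} → funToFin f ≡ funToFin g → f ≗ g
funToFin-injective {f = f} {g} eq l =
  trans (sym (finToFun-funToFin f l)) (trans (cong (λ u → finToFun u l) eq) (finToFun-funToFin g l))

finToFun-injective : ∀ {m n} {u v : Fin (n ^ m)} → finToFun u ≗ finToFun v → u ≡ v
finToFun-injective {m} {n} {u} {v} eq = begin
  u                                ≡⟨ funToFin-finToFin {m} {n} u ⟨
  funToFin {m} {n} (finToFun u)    ≡⟨ funToFin-cong {m} {n} eq ⟩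
  funToFin {m} {n} (finToFun v)    ≡⟨ funToFin-finToFin {m} {n} v ⟩
  v                                ∎
  where open ≡-Reasoning

lookup-injective : ∀ {A : Set} {xs : List A} → Unique xs → ∀ {i j} → List.lookup xs i ≡ List.lookup xs j → i ≡ j
lookup-injective (x∉xs ∷ xs!) {zero}  {zero}  _  = refl
lookup-injective (x∉xs ∷ xs!) {zero}  {suc j} eq = contradiction eq (All.lookup x∉xs (∈-lookup j))
lookup-injective (x∉xs ∷ xs!) {suc i} {zero}  eq = contradiction (sym eq) (All.lookup x∉xs (∈-lookup i))
lookup-injective (x∉xs ∷ xs!) {suc i} {suc j} eq = cong suc (lookup-injective xs! eq)

lookup-≗⇒≡ : ∀ {A : Set} {k} {u v : Vec A k} → lookup u ≗ lookup v → u ≡ v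
lookup-≗⇒≡ {u = u} {v} eq = trans (sym (tabulate∘lookup u)) (trans (tabulate-cong eq) (tabulate∘lookup v))

box : (k N : ℕ) → List (Vec ℕ k)
box zero    N = [] ∷ []
box (suc k) N = cartesianProductWith _∷_ (upTo N) (box k N)

∈-box : ∀ {k N} (v : Vec ℕ k) → (∀ l → lookup v l < N) → v ∈ₗ box k N
∈-box []      _     = Any.here refl
∈-box (a ∷ v) v<N = ∈-cartesianProductWith⁺ _∷_ (∈-upTo⁺ (v<N zero)) (∈-box v (v<N ∘ suc))

box-unique : ∀ k N → Unique (box k N)
box-unique zero    N = All.[] ∷ []
box-unique (suc k) N = cartesianProductWith⁺ _∷_ ∷-injective (upTo⁺ N) (box-unique k N)

-- The lattice construction

module Lattice (k w : ℕ) where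

  Point : Set
  Point = Fin k → ℕ

  centre top : ℕ
  centre = 2 * w
  top    = 3 * w

  centre≤top : centre ≤ top
  centre≤top = *-monoˡ-≤ w (n≤1+n 2)

  record InV (p : Point) : Set where
    field
      ≤centre+ : ∀ {a l} → a ≢ l → p l ≤ centre + p a
      centre≤+ : ∀ {a l} → a ≢ l → centre ≤ p l + p a
      ≤top     : ∀ l → p l ≤ top
  open InV

  inV? : ∀ p → Dec (InV p)
  inV? p = map′ to from (all? (λ a → all? (λ l → ¬? (a ≟ l) →-dec pair? a l)) ×-dec all? (λ l → p l ≤? top))
    where
    pair? : ∀ a l → Dec (p l ≤ centre + p a × centre ≤ p l + p a)
    pair? a l = (p l ≤? centre + p a) ×-dec (centre ≤? p l + p a)
    to : _ → InV p
    to (pairs , bounded) = record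
      { ≤centre+ = λ {a} {l} a≢l → proj₁ (pairs a l a≢l)
      ; centre≤+ = λ {a} {l} a≢l → proj₂ (pairs a l a≢l)
      ; ≤top     = bounded }
    from : InV p → _
    from p∈V = (λ a l a≢l → ≤centre+ p∈V a≢l , centre≤+ p∈V a≢l) , ≤top p∈V

  InV-resp-≗ : ∀ {p q} → p ≗ q → InV p → InV q
  InV-resp-≗ {p} {q} p≗q p∈V = record
    { ≤centre+ = λ {a} {l} a≢l → subst₂ (λ x y → x ≤ centre + y) (p≗q l) (p≗q a) (≤centre+ p∈V a≢l)
    ; centre≤+ = λ {a} {l} a≢l → subst₂ (λ x y → centre ≤ x + y) (p≗q l) (p≗q a) (centre≤+ p∈V a≢l)
    ; ≤top     = λ l → subst (_≤ top) (p≗q l) (≤top p∈V l) }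

  inner-box⊆V : ∀ {p} → (∀ l → w ≤ p l × p l ≤ top) → InV p
  inner-box⊆V {p} inBox = record
    { ≤centre+ = λ {a} {l} _ → ≤-trans (proj₂ (inBox l))
                   (≤-trans (≤-reflexive (+-comm w centre)) (+-monoʳ-≤ centre (proj₁ (inBox a))))
    ; centre≤+ = λ {a} {l} _ → ≤-trans (≤-reflexive (cong (w +_) (+-identityʳ w)))
                   (+-mono-≤ (proj₁ (inBox l)) (proj₁ (inBox a)))
    ; ≤top     = proj₂ ∘ inBox }

  landmark : Fin k → Point
  landmark i l with l ≟ i
  ... | yes _ = 0
  ... | no  _ = centre

  landmark-self : ∀ i → landmark i i ≡ 0
  landmark-self i with i ≟ i
  ... | yes _   = refl
  ... | no  i≢i = contradiction refl i≢i

  landmark-other : ∀ {i l} → l ≢ i → landmark i l ≡ centre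
  landmark-other {i} {l} l≢i with l ≟ i
  ... | yes l≡i = contradiction l≡i l≢i
  ... | no  _   = refl

  landmark≤centre : ∀ i l → landmark i l ≤ centre
  landmark≤centre i l with l ≟ i
  ... | yes _ = z≤n
  ... | no  _ = ≤-refl

  landmark-InV : ∀ i → InV (landmark i)
  landmark-InV i = record
    { ≤centre+ = λ {a} {l} _ → ≤-trans (landmark≤centre i l) (m≤m+n centre _)
    ; centre≤+ = centre≤+′
    ; ≤top     = λ l → ≤-trans (landmark≤centre i l) centre≤top }
    where
    centre≤+′ : ∀ {a l} → a ≢ l → centre ≤ landmark i l + landmark i a
    centre≤+′ {a} {l} a≢l with l ≟ i
    ... | yes refl = ≤-trans (≤-reflexive (sym (landmark-other a≢l))) (m≤n+m _ 0)
    ... | no  _    = m≤m+n centre _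

  InV-zero : ∀ {p i} → InV p → p i ≡ 0 → p ≗ landmark i
  InV-zero {p} {i} p∈V pi≡0 l with l ≟ i
  ... | yes refl = pi≡0
  ... | no  l≢i  = ≤-antisym
    (≤-trans (≤centre+ p∈V (l≢i ∘ sym)) (≤-reflexive (trans (cong (centre +_) pi≡0) (+-identityʳ centre))))
    (≤-trans (centre≤+ p∈V (l≢i ∘ sym)) (≤-reflexive (trans (cong (p l +_) pi≡0) (+-identityʳ (p l)))))

  -- One step of a towards the window [centre - t, centre + t].
  towards : ℕ → ℕ → ℕ
  towards t a with a + t <? centre | centre + t <? a
  ... | yes _ | _     = suc a
  ... | no _  | yes _ = pred a
  ... | no _  | no _  = a

  record Towards (t a y : ℕ) : Set where
    field
      ≤centre+t   : y ≤ centre + t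
      centre≤+t   : centre ≤ y + t
      ≤suc        : y ≤ suc a
      ≤suc⁻¹      : a ≤ suc y
      up-or-top   : a ≤ y ⊎ y ≡ centre + t
      down-or-low : y ≤ a ⊎ y ≤ centre
  open Towards

  towards-Towards : ∀ t a → a ≤ centre + suc t → centre ≤ a + suc t → Towards t a (towards t a)
  towards-Towards t a a≤ c≤ with a + t <? centre | centre + t <? a
  ... | yes a+t<c | _ = record
    { ≤centre+t = ≤-trans a<c (m≤m+n centre t) ; centre≤+t = ≤-trans c≤ (≤-reflexive (+-suc a t))
    ; ≤suc = ≤-refl ; ≤suc⁻¹ = m≤n⇒m≤1+n (n≤1+n a) ; up-or-top = inj₁ (n≤1+n a) ; down-or-low = inj₂ a<c }
    where
    a<c : suc a ≤ centre
    a<c = ≤-trans (s≤s (m≤m+n a t)) a+t<c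
  ... | no _ | yes c+t<a with refl ← ≤-antisym (≤-trans a≤ (≤-reflexive (+-suc centre t))) c+t<a = record
    { ≤centre+t = ≤-refl ; centre≤+t = ≤-trans (m≤m+n centre (t + t)) (≤-reflexive (sym (+-assoc centre t t)))
    ; ≤suc = m≤n⇒m≤1+n (n≤1+n _) ; ≤suc⁻¹ = ≤-refl ; up-or-top = inj₂ refl ; down-or-low = inj₁ (n≤1+n _) }
  ... | no a+t≮c | no c+t≮a = record
    { ≤centre+t = ≮⇒≥ c+t≮a ; centre≤+t = ≮⇒≥ a+t≮c
    ; ≤suc = n≤1+n a ; ≤suc⁻¹ = n≤1+n a ; up-or-top = inj₁ ≤-refl ; down-or-low = inj₁ ≤-refl }

  retreat : Fin k → Point → Point
  retreat i p l with l ≟ i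
  ... | yes _ = pred (p i)
  ... | no  _ = towards (pred (p i)) (p l)

  Close : Point → Point → Set
  Close p q = ∀ l → q l ≤ suc (p l) × p l ≤ suc (q l)

  close? : ∀ p q → Dec (Close p q)
  close? p q = all? (λ l → (q l ≤? suc (p l)) ×-dec (p l ≤? suc (q l)))

  close-sym : ∀ {p q} → Close p q → Close q p
  close-sym p~q l = proj₂ (p~q l) , proj₁ (p~q l)

  close-resp-≗ : ∀ {p q q′} → q ≗ q′ → Close p q → Close p q′
  close-resp-≗ {p} q≗q′ p~q l = subst (λ x → x ≤ suc (p l) × p l ≤ suc x) (q≗q′ l) (p~q l)

  module Retreat {i p t} (p∈V : InV p) (pi≡ : p i ≡ suc t) where

    private
      step : ∀ {l} → l ≢ i → Towards t (p l) (towards (pred (p i)) (p l))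
      step {l} l≢i rewrite pi≡ = towards-Towards t (p l)
        (subst (λ x → p l ≤ centre + x) pi≡ (≤centre+ p∈V (l≢i ∘ sym)))
        (subst (λ x → centre ≤ p l + x) pi≡ (centre≤+ p∈V (l≢i ∘ sym)))

      t≡ : pred (p i) ≡ t
      t≡ = cong pred pi≡

    retreat-self : retreat i p i ≡ t
    retreat-self with i ≟ i
    ... | yes _   = t≡
    ... | no  i≢i = contradiction refl i≢i

    retreat-close : Close p (retreat i p)
    retreat-close l with l ≟ i
    ... | yes refl rewrite pi≡ = m≤n⇒m≤1+n (n≤1+n t) , ≤-refl
    ... | no  l≢i  = ≤suc (step l≢i) , ≤suc⁻¹ (step l≢i)

    retreat-InV : InV (retreat i p)
    retreat-InV = record { ≤centre+ = ≤centre+′ ; centre≤+ = centre≤+′ ; ≤top = ≤top′ }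
      where
      q = retreat i p
      ≤centre+′ : ∀ {a l} → a ≢ l → q l ≤ centre + q a
      ≤centre+′ {a} {l} a≢l with l ≟ i | a ≟ i
      ... | yes refl | yes refl = contradiction refl a≢l
      ... | yes refl | no a≢i = ≤-pred (begin
        suc (pred (p i))   ≡⟨ trans (cong suc t≡) (sym pi≡) ⟩
        p i                ≤⟨ ≤centre+ p∈V a≢l ⟩
        centre + p a       ≤⟨ +-monoʳ-≤ centre (≤suc⁻¹ (step a≢i)) ⟩
        centre + suc _     ≡⟨ +-suc centre _ ⟩
        suc (centre + _)   ∎)
        where open ≤-Reasoning
      ... | no l≢i | yes refl = ≤-trans (≤centre+t (step l≢i)) (≤-reflexive (cong (centre +_) (sym t≡)))
      ... | no l≢i | no a≢i with up-or-top (step a≢i)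
      ...   | inj₂ qa≡ =
        ≤-trans (≤centre+t (step l≢i)) (+-monoʳ-≤ centre (≤-trans (m≤n+m t centre) (≤-reflexive (sym qa≡))))
      ...   | inj₁ pa≤qa with down-or-low (step l≢i)
      ...     | inj₁ ql≤pl = ≤-trans ql≤pl (≤-trans (≤centre+ p∈V a≢l) (+-monoʳ-≤ centre pa≤qa))
      ...     | inj₂ ql≤c  = ≤-trans ql≤c (m≤m+n centre _)
      centre≤+′ : ∀ {a l} → a ≢ l → centre ≤ q l + q a
      centre≤+′ {a} {l} a≢l with l ≟ i | a ≟ i
      ... | yes refl | yes refl = contradiction refl a≢l
      ... | yes refl | no a≢i = ≤-trans (centre≤+t (step a≢i)) (≤-reflexive (trans (+-comm _ t) (cong (_+ _) (sym t≡))))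
      ... | no l≢i | yes refl = ≤-trans (centre≤+t (step l≢i)) (≤-reflexive (cong (_ +_) (sym t≡)))
      ... | no l≢i | no a≢i with up-or-top (step l≢i) | up-or-top (step a≢i)
      ...   | inj₂ ql≡ | _        = ≤-trans (m≤m+n centre t) (≤-trans (≤-reflexive (sym ql≡)) (m≤m+n _ _))
      ...   | inj₁ _   | inj₂ qa≡ = ≤-trans (m≤m+n centre t) (≤-trans (≤-reflexive (sym qa≡)) (m≤n+m _ _))
      ...   | inj₁ pl≤ql | inj₁ pa≤qa = ≤-trans (centre≤+ p∈V a≢l) (+-mono-≤ pl≤ql pa≤qa)
      ≤top′ : ∀ l → q l ≤ top
      ≤top′ l with l ≟ i
      ... | yes refl rewrite pi≡ = ≤-trans (n≤1+n t) (subst (_≤ top) pi≡ (≤top p∈V i))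
      ... | no l≢i with down-or-low (step l≢i)
      ...   | inj₁ ql≤pl = ≤-trans ql≤pl (≤top p∈V l)
      ...   | inj₂ ql≤c  = ≤-trans ql≤c centre≤top

  vertices : List (Vec ℕ k)
  vertices = filter (inV? ∘ lookup) (box k (suc top))

  nV : ℕ
  nV = List.length vertices

  pt : Fin nV → Point
  pt i = lookup (List.lookup vertices i)

  pt-InV : ∀ i → InV (pt i)
  pt-InV i = proj₂ (∈-filter⁻ (inV? ∘ lookup) {xs = box k (suc top)} (∈-lookup i))

  pt-injective : ∀ {i j} → pt i ≗ pt j → i ≡ j
  pt-injective = lookup-injective (filter⁺ (inV? ∘ lookup) (box-unique k (suc top))) ∘ lookup-≗⇒≡

  ∈-vertices : ∀ {p} → InV p → tabulate p ∈ₗ vertices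
  ∈-vertices {p} p∈V = ∈-filter⁺ (inV? ∘ lookup)
    (∈-box (tabulate p) (λ l → s≤s (subst (_≤ top) (sym (lookup∘tabulate p l)) (≤top p∈V l))))
    (InV-resp-≗ (sym ∘ lookup∘tabulate p) p∈V)

  vertex : ∀ p → InV p → Fin nV
  vertex p p∈V = index (∈-vertices p∈V)

  pt-vertex : ∀ {p} (p∈V : InV p) → pt (vertex p p∈V) ≗ p
  pt-vertex {p} p∈V l = trans (cong (λ v → lookup v l) (sym (lookup-index (∈-vertices p∈V)))) (lookup∘tabulate p l)

  vertex-injective : ∀ {p q} (p∈V : InV p) (q∈V : InV q) → vertex p p∈V ≡ vertex q q∈V → p ≗ q
  vertex-injective p∈V q∈V eq l =
    trans (sym (pt-vertex p∈V l)) (trans (cong (λ v → pt v l) eq) (pt-vertex q∈V l))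

  nV≤ : nV ≤ suc top ^ k
  nV≤ = injective⇒≤ {f = encode} encode-injective
    where
    encode : Fin nV → Fin (suc top ^ k)
    encode i = funToFin (λ l → fromℕ< (s≤s (≤top (pt-InV i) l)))
    encode-injective : Injective _≡_ _≡_ encode
    encode-injective {i} {j} eq = pt-injective λ l → begin
      pt i l                                      ≡⟨ toℕ-fromℕ< _ ⟨
      toℕ (fromℕ< (s≤s (≤top (pt-InV i) l)))      ≡⟨ cong toℕ (funToFin-injective eq l) ⟩
      toℕ (fromℕ< (s≤s (≤top (pt-InV j) l)))      ≡⟨ toℕ-fromℕ< _ ⟩
      pt j l                                      ∎
      where open ≡-Reasoning

  shift : Point → ∀ {a} → Fin (a ^ k) → Point
  shift base u l = base l + toℕ (finToFun u l)

  shift-injective : ∀ base {a} {u u′ : Fin (a ^ k)} → shift base u ≗ shift base u′ → u ≡ u′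
  shift-injective base eq = finToFun-injective (λ l → toℕ-injective (+-cancelˡ-≡ (base l) _ _ (eq l)))

  count-shifts : ∀ base a {P : Point → Set} (P? : ∀ p → Dec (P p)) → (∀ {p q} → p ≗ q → P p → P q) →
                 (∀ (u : Fin (a ^ k)) → InV (shift base u) × P (shift base u)) →
                 a ^ k ≤ ∑[ i < nV ] χ ⌊ P? (pt i) ⌋
  count-shifts base a P? P-resp shifts =
    injective⇒≤∑χ (λ i → ⌊ P? (pt i) ⌋) {f = shiftVertex} shiftVertex-injective
      (λ u → fromWitness (P-resp (sym ∘ pt-vertex (proj₁ (shifts u))) (proj₂ (shifts u))))
    where
    shiftVertex : Fin (a ^ k) → Fin nV
    shiftVertex u = vertex (shift base u) (proj₁ (shifts u))
    shiftVertex-injective : Injective _≡_ _≡_ shiftVertex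
    shiftVertex-injective eq = shift-injective base (vertex-injective _ _ eq)

  Inner : Point → Set
  Inner p = ∀ l → w ≤ p l × p l < top

  inner? : ∀ p → Dec (Inner p)
  inner? p = all? (λ l → (w ≤? p l) ×-dec (p l <? top))

  inner-resp-≗ : ∀ {p q} → p ≗ q → Inner p → Inner q
  inner-resp-≗ p≗q inner l = subst (λ x → w ≤ x × x < top) (p≗q l) (inner l)

  inner-count : (2 * w) ^ k ≤ ∑[ i < nV ] χ ⌊ inner? (pt i) ⌋
  inner-count = count-shifts (λ _ → w) (2 * w) inner? inner-resp-≗ (λ u → inner-box⊆V (bounds u) , inner u)
    where
    inner : ∀ u → Inner (shift (λ _ → w) u)
    inner u l = m≤m+n w _ , +-monoʳ-< w (toℕ<n (finToFun u l))
    bounds : ∀ u l → w ≤ shift (λ _ → w) u l × shift (λ _ → w) u l ≤ top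
    bounds u l = proj₁ (inner u l) , <⇒≤ (proj₂ (inner u l))

  neighbour-count : ∀ {i} → Inner (pt i) → 2 ^ k ≤ ∑[ j < nV ] χ ⌊ close? (pt i) (pt j) ⌋
  neighbour-count {i} inner = count-shifts (pt i) 2 (close? (pt i)) close-resp-≗
    (λ e → inner-box⊆V (λ l → bounds l (bit e l)) , λ l → close l (bit e l))
    where
    bit : ∀ (e : Fin (2 ^ k)) l → toℕ (finToFun e l) ≤ 1
    bit e l = ≤-pred (toℕ<n (finToFun e l))
    bounds : ∀ l {x} → x ≤ 1 → w ≤ pt i l + x × pt i l + x ≤ top
    bounds l x≤1 = ≤-trans (proj₁ (inner l)) (m≤m+n _ _) ,
                   ≤-trans (+-monoʳ-≤ (pt i l) x≤1) (≤-trans (≤-reflexive (+-comm (pt i l) 1)) (proj₂ (inner l)))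
    close : ∀ l {x} → x ≤ 1 → pt i l + x ≤ suc (pt i l) × pt i l ≤ suc (pt i l + x)
    close l x≤1 = ≤-trans (+-monoʳ-≤ (pt i l) x≤1) (≤-reflexive (+-comm (pt i l) 1)) , m≤n⇒m≤1+n (m≤m+n _ _)

  closePairs : ℕ
  closePairs = ∑[ i < nV ] ∑[ j < nV ] χ ⌊ close? (pt i) (pt j) ⌋

  closePairs≥ : (4 * w) ^ k ≤ closePairs
  closePairs≥ = begin
    (4 * w) ^ k                                    ≡⟨ cong (_^ k) (*-assoc 2 2 w) ⟩
    (2 * (2 * w)) ^ k                              ≡⟨ ^-distribʳ-* 2 (2 * w) k ⟩
    2 ^ k * (2 * w) ^ k                            ≤⟨ *-monoʳ-≤ (2 ^ k) inner-count ⟩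
    2 ^ k * (∑[ i < nV ] χ ⌊ inner? (pt i) ⌋)      ≡⟨ *-distribˡ-sum (2 ^ k) (λ i → χ ⌊ inner? (pt i) ⌋) ⟩
    ∑[ i < nV ] (2 ^ k * χ ⌊ inner? (pt i) ⌋)      ≤⟨ ∑-mono-≤ row≥ ⟩
    closePairs                                     ∎
    where
    open ≤-Reasoning
    row≥ : ∀ i → 2 ^ k * χ ⌊ inner? (pt i) ⌋ ≤ ∑[ j < nV ] χ ⌊ close? (pt i) (pt j) ⌋
    row≥ i = χ-scale (2 ^ k) (neighbour-count ∘ toWitness)

  closeEdge : Fin nV → Fin nV → Bool
  closeEdge i j = i ≺ j ∧ ⌊ close? (pt i) (pt j) ⌋

  closePairs≤ : closePairs ≤ 2 * count₂ closeEdge + nV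
  closePairs≤ = begin
    closePairs
      ≤⟨ ∑-mono-≤ (λ i → ∑-mono-≤ (split i)) ⟩
    ∑[ i < nV ] ∑[ j < nV ] ((e i j + e j i) + δ i j)
      ≡⟨ sum-cong-≗ (λ i → ∑-distrib-+ (λ j → e i j + e j i) (δ i)) ⟩
    ∑[ i < nV ] (∑[ j < nV ] (e i j + e j i) + ∑[ j < nV ] δ i j)
      ≡⟨ ∑-distrib-+ (λ i → ∑[ j < nV ] (e i j + e j i)) (λ i → ∑[ j < nV ] δ i j) ⟩
    ∑[ i < nV ] ∑[ j < nV ] (e i j + e j i) + ∑[ i < nV ] ∑[ j < nV ] δ i j
      ≤⟨ +-mono-≤ (≤-reflexive (∑∑-symmetrise e)) (∑-≤-* 1 diagonal) ⟩
    (count₂ closeEdge + count₂ closeEdge) + nV * 1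
      ≡⟨ cong₂ _+_ (cong (count₂ closeEdge +_) (sym (+-identityʳ _))) (*-identityʳ nV) ⟩
    2 * count₂ closeEdge + nV
      ∎
    where
    open ≤-Reasoning
    e δ : Fin nV → Fin nV → ℕ
    e i j = χ (closeEdge i j)
    δ i j = χ ⌊ i ≟ j ⌋
    split : ∀ i j → χ ⌊ close? (pt i) (pt j) ⌋ ≤
                    (χ (i ≺ j ∧ ⌊ close? (pt i) (pt j) ⌋) + χ (j ≺ i ∧ ⌊ close? (pt j) (pt i) ⌋)) + χ ⌊ i ≟ j ⌋
    split i j = χ-split {i ≺ j} {j ≺ i} {⌊ close? (pt i) (pt j) ⌋} {⌊ close? (pt j) (pt i) ⌋} {⌊ i ≟ j ⌋}
      (λ ¬i≡j → ≺-connex (¬i≡j ∘ fromWitness))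
      (fromWitness {a? = close? (pt j) (pt i)} ∘ close-sym ∘ toWitness {a? = close? (pt i) (pt j)})
    diagonal : ∀ i → ∑[ j < nV ] δ i j ≤ 1
    diagonal i = ∑χ≤1 (λ j → ⌊ i ≟ j ⌋) (λ i≡j i≡j′ → trans (sym (toWitness i≡j)) (toWitness i≡j′))

  _≗?_ : ∀ (p q : Point) → Dec (p ≗ q)
  p ≗? q = all? (λ l → p l ≟ℕ q l)

  Skel : Fin nV → Fin nV → Set
  Skel i j = ∃ λ l → 1 ≤ pt i l × pt j ≗ retreat l (pt i)

  skel? : ∀ i j → Dec (Skel i j)
  skel? i j = any? (λ l → (1 ≤? pt i l) ×-dec (pt j ≗? retreat l (pt i)))

  skel-row : ∀ i → ∑[ j < nV ] χ ⌊ skel? i j ⌋ ≤ k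
  skel-row i = begin
    ∑[ j < nV ] χ ⌊ skel? i j ⌋
      ≤⟨ ∑-mono-≤ (λ j → χ-any≤∑χ (λ l → (1 ≤? pt i l) ×-dec (pt j ≗? q l))) ⟩
    ∑[ j < nV ] ∑[ l < k ] χ ⌊ (1 ≤? pt i l) ×-dec (pt j ≗? q l) ⌋
      ≤⟨ ∑-mono-≤ (λ j → ∑-mono-≤ (λ l → second j l)) ⟩
    ∑[ j < nV ] ∑[ l < k ] χ ⌊ pt j ≗? q l ⌋
      ≡⟨ ∑-comm (λ j l → χ ⌊ pt j ≗? q l ⌋) ⟩
    ∑[ l < k ] ∑[ j < nV ] χ ⌊ pt j ≗? q l ⌋
      ≤⟨ ∑-≤-* 1 (λ l → ∑χ≤1 (λ j → ⌊ pt j ≗? q l ⌋) (unique l)) ⟩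
    k * 1
      ≡⟨ *-identityʳ k ⟩
    k
      ∎
    where
    open ≤-Reasoning
    q : Fin k → Point
    q l = retreat l (pt i)
    second : ∀ j l → χ ⌊ (1 ≤? pt i l) ×-dec (pt j ≗? q l) ⌋ ≤ χ ⌊ pt j ≗? q l ⌋
    second j l = χ-mono (fromWitness ∘ proj₂ ∘ toWitness {a? = (1 ≤? pt i l) ×-dec (pt j ≗? q l)})
    unique : ∀ l {j j′} → T ⌊ pt j ≗? q l ⌋ → T ⌊ pt j′ ≗? q l ⌋ → j ≡ j′
    unique l {j} {j′} j≗ j′≗ =
      pt-injective (λ x → trans (toWitness {a? = pt j ≗? q l} j≗ x) (sym (toWitness {a? = pt j′ ≗? q l} j′≗ x)))

  skelEdge : Fin nV → Fin nV → Bool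
  skelEdge i j = i ≺ j ∧ (⌊ skel? i j ⌋ ∨ ⌊ skel? j i ⌋)

  skelEdges≤2nVk : count₂ skelEdge ≤ 2 * (nV * k)
  skelEdges≤2nVk = begin
    count₂ skelEdge                                   ≤⟨ ∑-mono-≤ (λ i → ∑-mono-≤ (skelEdge≤ i)) ⟩
    ∑[ i < nV ] ∑[ j < nV ] (s i j + s j i)           ≡⟨ ∑∑-symmetrise s ⟩
    ∑[ i < nV ] ∑[ j < nV ] s i j + ∑[ i < nV ] ∑[ j < nV ] s i j
                                                      ≤⟨ +-mono-≤ (∑-≤-* k skel-row) (∑-≤-* k skel-row) ⟩
    nV * k + nV * k                                   ≡⟨ cong (nV * k +_) (sym (+-identityʳ _)) ⟩
    2 * (nV * k)                                      ∎
    where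
    open ≤-Reasoning
    s : Fin nV → Fin nV → ℕ
    s i j = χ ⌊ skel? i j ⌋
    skelEdge≤ : ∀ i j → χ (skelEdge i j) ≤ s i j + s j i
    skelEdge≤ i j = bool (i ≺ j) (⌊ skel? i j ⌋) (⌊ skel? j i ⌋)
      where
      bool : ∀ a b c → χ (a ∧ (b ∨ c)) ≤ χ b + χ c
      bool false b     c = z≤n
      bool true  true  c = s≤s z≤n
      bool true  false c = ≤-refl

  skel⇒close : ∀ {i j} → Skel i j → Close (pt i) (pt j)
  skel⇒close {i} (l , 1≤pil , pj≗) = close-resp-≗ (sym ∘ pj≗) (Retreat.retreat-close (pt-InV i) (suc-pred⁻¹ 1≤pil))
    where
    suc-pred⁻¹ : ∀ {x} → 1 ≤ x → x ≡ suc (pred x)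
    suc-pred⁻¹ (s≤s _) = refl

  skelEdge-intro : ∀ {i j} → T (i ≺ j) → Skel i j ⊎ Skel j i → T (skelEdge i j)
  skelEdge-intro {i} {j} i≺j s = Equivalence.from (T-∧ {i ≺ j}) (i≺j ,
    Equivalence.from (T-∨ {⌊ skel? i j ⌋} {⌊ skel? j i ⌋})
      (map-⊎ (fromWitness {a? = skel? i j}) (fromWitness {a? = skel? j i}) s))

  skelEdge⇒closeEdge : ∀ i j → T (skelEdge i j) → T (closeEdge i j)
  skelEdge⇒closeEdge i j e = Equivalence.from (T-∧ {i ≺ j} {⌊ close? (pt i) (pt j) ⌋}) (proj₁ i≺j∧s ,
    fromWitness {a? = close? (pt i) (pt j)} ([ skel⇒close , close-sym ∘ skel⇒close ]′
      (map-⊎ (toWitness {a? = skel? i j}) (toWitness {a? = skel? j i})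
        (Equivalence.to (T-∨ {⌊ skel? i j ⌋} {⌊ skel? j i ⌋}) (proj₂ i≺j∧s)))))
    where
    i≺j∧s : T (i ≺ j) × T (⌊ skel? i j ⌋ ∨ ⌊ skel? j i ⌋)
    i≺j∧s = Equivalence.to (T-∧ {i ≺ j} {⌊ skel? i j ⌋ ∨ ⌊ skel? j i ⌋}) e

  landmarkVertex : Fin k → Fin nV
  landmarkVertex l = vertex (landmark l) (landmark-InV l)

  module Realisation (C : Fin nV → Fin nV → Bool)
                     (skel⊆C : ∀ i j → T (skelEdge i j) → T (C i j))
                     (C⊆close : ∀ i j → T (C i j) → T (closeEdge i j)) where

    G : Graph
    G = graphOn nV C

    C⇒close : ∀ i j → T (C i j) → Close (pt i) (pt j)
    C⇒close i j c = toWitness (proj₂ (Equivalence.to (T-∧ {i ≺ j} {⌊ close? (pt i) (pt j) ⌋}) (C⊆close i j c)))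

    adj⇒close : ∀ {z y} → T (adj G z y) → Close (pt z) (pt y)
    adj⇒close {z} {y} z~y = [ C⇒close z y ∘ proj₂ ∘ Equivalence.to (T-∧ {z ≺ y} {C z y})
                            , close-sym ∘ C⇒close y z ∘ proj₂ ∘ Equivalence.to (T-∧ {y ≺ z} {C y z}) ]′
                            (Equivalence.to (T-∨ {z ≺ y ∧ C z y} {y ≺ z ∧ C y z}) z~y)

    edge : ∀ {i j} → T (i ≺ j) → T (C i j) → T (adj G i j)
    edge {i} {j} i≺j c =
      Equivalence.from (T-∨ {i ≺ j ∧ C i j} {j ≺ i ∧ C j i}) (inj₁ (Equivalence.from (T-∧ {i ≺ j}) (i≺j , c)))

    skel⇒adj : ∀ {u v} → u ≢ v → Skel v u → T (adj G u v)
    skel⇒adj {u} {v} u≢v s = [ forward , backward ]′ (≺-connex u≢v)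
      where
      forward : T (u ≺ v) → T (adj G u v)
      forward u≺v = edge {u} {v} u≺v (skel⊆C u v (skelEdge-intro {u} {v} u≺v (inj₂ s)))
      backward : T (v ≺ u) → T (adj G u v)
      backward v≺u = subst T (Graph.sym G v u) (edge {v} {u} v≺u (skel⊆C v u (skelEdge-intro {v} {u} v≺u (inj₁ s))))

    coordinate-Lipschitz : ∀ l → Lipschitz G (λ v → pt v l)
    coordinate-Lipschitz l z~y = proj₁ (adj⇒close z~y l)

    -- Retreating along l is an edge of G that lowers coordinate l by one.
    reach-landmark : ∀ l t v → pt v l ≡ t → T (reach G t (landmarkVertex l) v)
    reach-landmark l zero v pvl≡0 = subst (T ∘ reach G 0 (landmarkVertex l)) lm≡v (reach-refl G (landmarkVertex l))
      where
      lm≡v : landmarkVertex l ≡ v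
      lm≡v = pt-injective (λ x → trans (pt-vertex (landmark-InV l) x) (sym (InV-zero (pt-InV v) pvl≡0 x)))
    reach-landmark l (suc t) v pvl≡ = reach-suc G {t} {landmarkVertex l} {u} {v}
      (reach-landmark l t u put≡t) (skel⇒adj u≢v (l , 1≤pvl , pt-vertex retreat-InV))
      where
      open Retreat (pt-InV v) pvl≡
      u : Fin nV
      u = vertex (retreat l (pt v)) retreat-InV
      put≡t : pt u l ≡ t
      put≡t = trans (pt-vertex retreat-InV l) retreat-self
      u≢v : u ≢ v
      u≢v u≡v = 1+n≢n (trans (sym pvl≡) (trans (cong (λ x → pt x l) (sym u≡v)) put≡t))
      1≤pvl : 1 ≤ pt v l
      1≤pvl = subst (1 ≤_) (sym pvl≡) (s≤s z≤n)

    distR-landmark : ∀ l v → distR G top (landmarkVertex l) v ≡ pt v l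
    distR-landmark l v = distR≡ G (coordinate-Lipschitz l) top
      (trans (pt-vertex (landmark-InV l) l) (landmark-self l)) (≤top (pt-InV v) l) (reach-landmark l (pt v l) v refl)

    landmarks-resolve : Resolving G top (image landmarkVertex)
    landmarks-resolve x y x≢y =
      let l , differ = ¬∀⟶∃¬ k (λ l → pt x l ≡ pt y l) (λ l → pt x l ≟ℕ pt y l) (x≢y ∘ pt-injective)
      in landmarkVertex l , ∈-image landmarkVertex l ,
         λ eq → differ (trans (sym (distR-landmark l x)) (trans eq (distR-landmark l y)))

  skelEdges≤ : ∀ {m} → 2 * (suc top ^ k * k) ≤ m → count₂ skelEdge ≤ m
  skelEdges≤ lo≤m = ≤-trans skelEdges≤2nVk (≤-trans (*-monoʳ-≤ 2 (*-monoˡ-≤ k nV≤)) lo≤m)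

  closeEdges≥ : ∀ {m} → 4 * m ≤ (4 * w) ^ k → 2 * suc top ^ k ≤ (4 * w) ^ k → m ≤ count₂ closeEdge
  closeEdges≥ {m} 4m≤ 2N^k≤ = *-cancelˡ-≤ 4 (+-cancelʳ-≤ (2 * nV) (4 * m) (4 * count₂ closeEdge) (begin
    4 * m + 2 * nV                                    ≤⟨ +-mono-≤ 4m≤ (≤-trans (*-monoʳ-≤ 2 nV≤) 2N^k≤) ⟩
    (4 * w) ^ k + (4 * w) ^ k                         ≤⟨ +-mono-≤ closePairs-bounds closePairs-bounds ⟩
    (2 * count₂ closeEdge + nV) + (2 * count₂ closeEdge + nV)  ≡⟨ double (count₂ closeEdge) nV ⟩
    4 * count₂ closeEdge + 2 * nV                     ∎))
    where
    open ≤-Reasoning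
    closePairs-bounds : (4 * w) ^ k ≤ 2 * count₂ closeEdge + nV
    closePairs-bounds = ≤-trans closePairs≥ closePairs≤
    double : ∀ c n → (2 * c + n) + (2 * c + n) ≡ 4 * c + 2 * n
    double = solve-∀

  realise : ∀ {m} C → (∀ i j → T (skelEdge i j) → T (C i j)) → (∀ i j → T (C i j) → T (closeEdge i j)) →
            count₂ C ≡ m → ∃ λ G → edgeCount G ≡ m × ∃ λ S → Resolving G top S × ∣ S ∣ ≤ k
  realise C skel⊆C C⊆close count≡m =
    G , trans (edgeCount-graphOn nV C C⇒≺) count≡m , image landmarkVertex , landmarks-resolve , ∣image∣≤ landmarkVertex
    where
    open Realisation C skel⊆C C⊆close
    C⇒≺ : ∀ {i j} → T (C i j) → T (i ≺ j)
    C⇒≺ {i} {j} = proj₁ ∘ Equivalence.to (T-∧ {i ≺ j} {⌊ close? (pt i) (pt j) ⌋}) ∘ C⊆close i j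

  construct : ∀ m → 2 * (suc top ^ k * k) ≤ m → 4 * m ≤ (4 * w) ^ k → 2 * suc top ^ k ≤ (4 * w) ^ k →
              ∃ λ G → edgeCount G ≡ m × ∃ λ S → Resolving G top S × ∣ S ∣ ≤ k
  construct m lo≤m 4m≤ 2N^k≤ =
    let C , skel⊆C , C⊆close , count≡m =
          select₂ skelEdge closeEdge skelEdge⇒closeEdge (skelEdges≤ lo≤m) (closeEdges≥ 4m≤ 2N^k≤)
    in realise C skel⊆C C⊆close count≡m

-- Choosing the parameters

window-covering : ∀ (lo hi : ℕ → ℕ) {m} s fuel → (∀ j → s ≤ j → lo (suc j) ≤ hi j) →
                  lo s ≤ m → m ≤ hi (fuel + s) → ∃ λ j → s ≤ j × lo j ≤ m × m ≤ hi j
window-covering lo hi s zero _ lo≤m m≤hi = s , ≤-refl , lo≤m , m≤hi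
window-covering lo hi {m} s (suc fuel) overlaps lo≤m m≤hi with m ≤? hi s
... | yes m≤his = s , ≤-refl , lo≤m , m≤his
... | no  m≰his
  with j , s<j , loj≤m , m≤hij ← window-covering lo hi (suc s) fuel (λ j s<j → overlaps j (<⇒≤ s<j))
                                   (≤-trans (overlaps s ≤-refl) (<⇒≤ (≰⇒> m≰his)))
                                   (subst (λ x → m ≤ hi x) (sym (+-suc fuel s)) m≤hi) =
  j , <⇒≤ s<j , loj≤m , m≤hij

-- poly≤exp below first holds at 54; K₀ is a convenient value above it.
K₀ : ℕ
K₀ = 64

-- Lattice.construct k k m applies when threshold k ≤ m and 4 m ≤ ceiling k.
threshold ceiling : ℕ → ℕ
threshold k = 2 * (suc (3 * k) ^ k * k)
ceiling   k = (4 * k) ^ k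

poly-step : ∀ j → 8 ≤ j → 13 * (suc (suc j) * (3 * suc j + 4)) ≤ 16 * (suc j * (3 * j + 4))
poly-step j 8≤j = subst (λ x → 13 * (suc (suc x) * (3 * suc x + 4)) ≤ 16 * (suc x * (3 * x + 4)))
  (m∸n+n≡m 8≤j) (≤-trans (m≤m+n _ _) (≤-reflexive (sym (expand (j ∸ 8)))))
  where
  expand : ∀ d → 16 * (suc (d + 8) * (3 * (d + 8) + 4))
                 ≡ 13 * (suc (suc (d + 8)) * (3 * suc (d + 8) + 4)) + (9 * d * d + 87 * d + 2)
  expand = solve-∀

poly≤exp : ∀ j → K₀ ≤ j → 8 * (suc j * (3 * j + 4)) * 13 ^ j ≤ 16 ^ j
poly≤exp j K₀≤j = subst P (m∸n+n≡m K₀≤j) (from-K₀ (j ∸ K₀))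
  where
  P : ℕ → Set
  P j = 8 * (suc j * (3 * j + 4)) * 13 ^ j ≤ 16 ^ j
  step : ∀ j → 8 ≤ j → P j → P (suc j)
  step j 8≤j Pj = begin
    8 * (suc (suc j) * (3 * suc j + 4)) * 13 ^ suc j     ≡⟨ regroup (suc (suc j) * (3 * suc j + 4)) (13 ^ j) ⟩
    13 * (suc (suc j) * (3 * suc j + 4)) * (8 * 13 ^ j)  ≤⟨ *-monoˡ-≤ (8 * 13 ^ j) (poly-step j 8≤j) ⟩
    16 * (suc j * (3 * j + 4)) * (8 * 13 ^ j)            ≡⟨ regroup′ (suc j * (3 * j + 4)) (13 ^ j) ⟩
    16 * (8 * (suc j * (3 * j + 4)) * 13 ^ j)            ≤⟨ *-monoʳ-≤ 16 Pj ⟩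
    16 ^ suc j                                           ∎
    where
    open ≤-Reasoning
    regroup : ∀ a b → 8 * a * (13 * b) ≡ 13 * a * (8 * b)
    regroup = solve-∀
    regroup′ : ∀ a b → 16 * a * (8 * b) ≡ 16 * (8 * a * b)
    regroup′ = solve-∀
  from-K₀ : ∀ d → P (d + K₀)
  from-K₀ zero    = ≤ᵇ⇒≤ _ _ _
  from-K₀ (suc d) = step (d + K₀) (≤-trans (≤ᵇ⇒≤ 8 K₀ _) (m≤n+m K₀ d)) (from-K₀ d)

overlaps : ∀ j → K₀ ≤ j → 4 * threshold (suc j) ≤ ceiling j
overlaps j K₀≤j = *-cancelˡ-≤ (16 ^ j) {{m^n≢0 16 j}} (begin
  16 ^ j * (4 * threshold (suc j))               ≡⟨ regroup j X (16 ^ j) (X ^ j) ⟩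
  8 * (suc j * X) * (16 ^ j * X ^ j)             ≡⟨ cong (8 * (suc j * X) *_) (^-distribʳ-* 16 X j) ⟨
  8 * (suc j * X) * (16 * X) ^ j                 ≤⟨ *-monoʳ-≤ (8 * (suc j * X)) (^-monoˡ-≤ j 16X≤) ⟩
  8 * (suc j * X) * (13 * (4 * j)) ^ j           ≡⟨ cong (8 * (suc j * X) *_) (^-distribʳ-* 13 (4 * j) j) ⟩
  8 * (suc j * X) * (13 ^ j * (4 * j) ^ j)       ≡⟨ *-assoc (8 * (suc j * X)) (13 ^ j) ((4 * j) ^ j) ⟨
  8 * (suc j * X) * 13 ^ j * (4 * j) ^ j         ≤⟨ *-monoˡ-≤ ((4 * j) ^ j) poly≤16^j ⟩
  16 ^ j * ceiling j                             ∎)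
  where
  open ≤-Reasoning
  X : ℕ
  X = suc (3 * suc j)
  poly≤16^j : 8 * (suc j * X) * 13 ^ j ≤ 16 ^ j
  poly≤16^j = subst (λ x → 8 * (suc j * x) * 13 ^ j ≤ 16 ^ j) (sym (expand j)) (poly≤exp j K₀≤j)
    where
    expand : ∀ j → suc (3 * suc j) ≡ 3 * j + 4
    expand = solve-∀
  regroup : ∀ j x a b → a * (4 * (2 * (x * b * suc j))) ≡ 8 * (suc j * x) * (a * b)
  regroup = solve-∀
  16X≤ : 16 * X ≤ 13 * (4 * j)
  16X≤ = subst (λ x → 16 * suc (3 * suc x) ≤ 13 * (4 * x)) (m∸n+n≡m 16≤j)
           (≤-trans (m≤m+n _ _) (≤-reflexive (sym (expand (j ∸ 16)))))
    where
    16≤j : 16 ≤ j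
    16≤j = ≤-trans (≤ᵇ⇒≤ 16 K₀ _) K₀≤j
    expand : ∀ d → 13 * (4 * (d + 16)) ≡ 16 * suc (3 * suc (d + 16)) + 4 * d
    expand = solve-∀

ceiling-unbounded : ∀ m → 4 * m ≤ ceiling (m + K₀)
ceiling-unbounded m =
  ≤-trans (*-monoʳ-≤ 4 (m≤m+n m K₀)) (x≤x^n {4 * (m + K₀)} (≤-trans 1≤m+K₀ (m≤n*m (m + K₀) 4)) 1≤m+K₀)
  where
  1≤m+K₀ : 1 ≤ m + K₀
  1≤m+K₀ = ≤-trans (s≤s z≤n) (m≤n+m K₀ m)
  x≤x^n : ∀ {x n} → 1 ≤ x → 1 ≤ n → x ≤ x ^ n
  x≤x^n {x} {suc n} 1≤x _ = ≤-trans (≤-reflexive (sym (*-identityʳ x))) (*-monoʳ-≤ x (1≤^ n 1≤x))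

choose-k : ∀ m → threshold K₀ ≤ m → ∃ λ k → K₀ ≤ k × threshold k ≤ m × 4 * m ≤ ceiling k
choose-k m K₀≤m =
  let k , K₀≤k , 4thr≤4m , 4m≤ceil = window-covering (λ k → 4 * threshold k) ceiling K₀ m overlaps
                                         (*-monoʳ-≤ 4 K₀≤m) (ceiling-unbounded m)
  in k , K₀≤k , *-cancelˡ-≤ 4 4thr≤4m , 4m≤ceil

2^[⌊log₂k⌋*k]≤threshold : ∀ {k} → 1 ≤ k → 2 ^ (⌊log₂ k ⌋ * k) ≤ threshold k
2^[⌊log₂k⌋*k]≤threshold {k} 1≤k = begin
  2 ^ (⌊log₂ k ⌋ * k)       ≡⟨ ^-*-assoc 2 ⌊log₂ k ⌋ k ⟨
  (2 ^ ⌊log₂ k ⌋) ^ k       ≤⟨ ^-monoˡ-≤ k (≤-trans (2^⌊log₂n⌋≤n 1≤k) (≤-trans (m≤n*m k 3) (n≤1+n _))) ⟩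
  suc (3 * k) ^ k           ≡⟨ *-identityʳ (suc (3 * k) ^ k) ⟨
  suc (3 * k) ^ k * 1       ≤⟨ *-monoʳ-≤ (suc (3 * k) ^ k) 1≤k ⟩
  suc (3 * k) ^ k * k       ≤⟨ m≤n*m _ 2 ⟩
  threshold k               ∎
  where open ≤-Reasoning

⌊log₂⌊log₂m⌋⌋≤4⌊log₂k⌋ : ∀ {k m} → 2 ≤ k → 1 ≤ m → 4 * m ≤ ceiling k →
                         ⌊log₂ ⌊log₂ m ⌋ ⌋ ≤ 4 * ⌊log₂ k ⌋
⌊log₂⌊log₂m⌋⌋≤4⌊log₂k⌋ {k} {m} 2≤k 1≤m 4m≤ceil =
  ≤-trans (<2^⇒⌊log₂⌋≤ (suc (ℓ + suc ℓ)) L<2^) (≤-trans (≤-reflexive (cong suc (+-suc ℓ ℓ))) 2+2ℓ≤4ℓ)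
  where
  open ≤-Reasoning
  ℓ = ⌊log₂ k ⌋
  1≤ℓ : 1 ≤ ℓ
  1≤ℓ = 2^≤⇒≤⌊log₂⌋ 2≤k
  k<2^ : k < 2 ^ suc ℓ
  k<2^ = n<2^suc⌊log₂n⌋ k
  m<2^ : m < 2 ^ ((2 + suc ℓ) * k)
  m<2^ = begin-strict
    m                              <⟨ ≤-trans (≤-reflexive (+-comm 1 m)) (+-monoʳ-≤ m (≤-trans 1≤m (m≤n*m m 3))) ⟩
    4 * m                          ≤⟨ 4m≤ceil ⟩
    (4 * k) ^ k                    ≤⟨ ^-monoˡ-≤ k (*-monoʳ-≤ 4 (<⇒≤ k<2^)) ⟩
    (2 ^ 2 * 2 ^ suc ℓ) ^ k        ≡⟨ cong (_^ k) (^-distribˡ-+-* 2 2 (suc ℓ)) ⟨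
    (2 ^ (2 + suc ℓ)) ^ k          ≡⟨ ^-*-assoc 2 (2 + suc ℓ) k ⟩
    2 ^ ((2 + suc ℓ) * k)          ∎
  L<2^ : ⌊log₂ m ⌋ < 2 ^ suc (suc (ℓ + suc ℓ))
  L<2^ = begin-strict
    ⌊log₂ m ⌋                      <⟨ <2^⇒⌊log₂⌋< 1≤m m<2^ ⟩
    (3 + ℓ) * k                    ≤⟨ *-monoˡ-≤ k (≤-trans (≤-reflexive (+-comm 3 ℓ)) (+-monoʳ-≤ ℓ 3≤3ℓ)) ⟩
    (ℓ + 3 * ℓ) * k                ≤⟨ *-mono-≤ (≤-reflexive (ℓ+3ℓ ℓ)) (<⇒≤ k<2^) ⟩
    4 * ℓ * 2 ^ suc ℓ              <⟨ *-monoˡ-< (2 ^ suc ℓ) {{m^n≢0 2 (suc ℓ)}} (*-monoʳ-< 4 (n<2^n ℓ)) ⟩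
    4 * 2 ^ ℓ * 2 ^ suc ℓ          ≡⟨ regroup (2 ^ ℓ) (2 ^ suc ℓ) ⟩
    2 * (2 * (2 ^ ℓ * 2 ^ suc ℓ))  ≡⟨ cong (λ e → 2 * (2 * e)) (^-distribˡ-+-* 2 ℓ (suc ℓ)) ⟨
    2 ^ suc (suc (ℓ + suc ℓ))      ∎
    where
    3≤3ℓ : 3 ≤ 3 * ℓ
    3≤3ℓ = ≤-trans (≤-reflexive (sym (*-identityʳ 3))) (*-monoʳ-≤ 3 1≤ℓ)
    ℓ+3ℓ : ∀ ℓ → ℓ + 3 * ℓ ≡ 4 * ℓ
    ℓ+3ℓ = solve-∀
    regroup : ∀ a b → 4 * a * b ≡ 2 * (2 * (a * b))
    regroup = solve-∀
  2+2ℓ≤4ℓ : suc (suc (ℓ + ℓ)) ≤ 4 * ℓ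
  2+2ℓ≤4ℓ = ≤-trans (+-monoˡ-≤ (ℓ + ℓ) (*-monoʳ-≤ 2 1≤ℓ)) (≤-reflexive (double ℓ))
    where
    double : ∀ ℓ → 2 * ℓ + (ℓ + ℓ) ≡ 4 * ℓ
    double = solve-∀

log-upperBound : ∀ k m s → K₀ ≤ k → threshold k ≤ m → 4 * m ≤ ceiling k → s ≤ k →
                 (3 * k + s) * ⌊log₂ ⌊log₂ m ⌋ ⌋ ≤ 16 * ⌊log₂ m ⌋
log-upperBound k m s K₀≤k thr≤m 4m≤ceil s≤k = begin
  (3 * k + s) * ⌊log₂ ⌊log₂ m ⌋ ⌋   ≤⟨ *-mono-≤ (≤-trans (+-monoʳ-≤ (3 * k) s≤k) (≤-reflexive (3k+k k))) LL≤4ℓ ⟩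
  (4 * k) * (4 * ℓ)                 ≡⟨ regroup k ℓ ⟩
  16 * (ℓ * k)                      ≤⟨ *-monoʳ-≤ 16 (2^≤⇒≤⌊log₂⌋ {ℓ * k} 2^ℓk≤m) ⟩
  16 * ⌊log₂ m ⌋                    ∎
  where
  open ≤-Reasoning
  ℓ = ⌊log₂ k ⌋
  2≤k : 2 ≤ k
  2≤k = ≤-trans (≤ᵇ⇒≤ 2 K₀ _) K₀≤k
  2^ℓk≤m : 2 ^ (ℓ * k) ≤ m
  2^ℓk≤m = ≤-trans (2^[⌊log₂k⌋*k]≤threshold (<⇒≤ 2≤k)) thr≤m
  LL≤4ℓ : ⌊log₂ ⌊log₂ m ⌋ ⌋ ≤ 4 * ℓ
  LL≤4ℓ = ⌊log₂⌊log₂m⌋⌋≤4⌊log₂k⌋ 2≤k (≤-trans (m^n>0 2 (ℓ * k)) 2^ℓk≤m) 4m≤ceil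
  3k+k : ∀ k → 3 * k + k ≡ 4 * k
  3k+k = solve-∀
  regroup : ∀ k ℓ → 4 * k * (4 * ℓ) ≡ 16 * (ℓ * k)
  regroup = solve-∀

vertices-bound : ∀ k → K₀ ≤ k → 2 * suc (3 * k) ^ k ≤ ceiling k
vertices-bound k K₀≤k = ≤-trans (*-monoʳ-≤ 2 N^k≤) (≤-trans (m≤n*m (threshold (suc k)) 4) (overlaps k K₀≤k))
  where
  N^k≤ : suc (3 * k) ^ k ≤ suc (3 * suc k) ^ suc k * suc k
  N^k≤ = begin
    suc (3 * k) ^ k                        ≤⟨ ^-monoˡ-≤ k (s≤s (*-monoʳ-≤ 3 (n≤1+n k))) ⟩
    suc (3 * suc k) ^ k                    ≤⟨ m≤n*m _ (suc (3 * suc k)) ⟩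
    suc (3 * suc k) ^ suc k                ≤⟨ m≤m*n _ (suc k) ⟩
    suc (3 * suc k) ^ suc k * suc k        ∎
    where open ≤-Reasoning

upperBound : ∀ m → threshold K₀ ≤ m →
             ∃ λ G → edgeCount G ≡ m × ∃ λ r → ∃ λ S → Resolving G r S ×
               (r + ∣ S ∣) * ⌊log₂ ⌊log₂ m ⌋ ⌋ ≤ 16 * ⌊log₂ m ⌋
upperBound m thr≤m =
  let k , K₀≤k , thrₖ≤m , 4m≤ceil = choose-k m thr≤m
      G , edges≡m , S , resolves , ∣S∣≤k = Lattice.construct k k m thrₖ≤m 4m≤ceil (vertices-bound k K₀≤k)
  in G , edges≡m , 3 * k , S , resolves , log-upperBound k m ∣ S ∣ K₀≤k thrₖ≤m 4m≤ceil ∣S∣≤k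

mainTheorem5 : ∃ λ (a : ℕ) → ∃ λ (b : ℕ) → ∃ λ (M : ℕ) → ∀ (m : ℕ) → M ≤ m →
    ((∀ (G : Graph) → edgeCount G ≡ m → ∀ (r : ℕ) (S : Subset (n G)) → Resolving G r S →
    ⌊log₂ m ⌋ ≤ a * ((r + ∣ S ∣) * ⌊log₂ ⌊log₂ m ⌋ ⌋))
    × (∃ λ (G : Graph) → edgeCount G ≡ m × ∃ λ (r : ℕ) → ∃ λ (S : Subset (n G)) → Resolving G r S ×
    ((r + ∣ S ∣) * ⌊log₂ ⌊log₂ m ⌋ ⌋ ≤ b * ⌊log₂ m ⌋)))
mainTheorem5 = 4 , 16 , threshold K₀ , λ m thr≤m →
  lowerBound m (≤-trans (≤ᵇ⇒≤ 4 (threshold K₀) _) thr≤m) , upperBound m thr≤m
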